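{- For all (possibly open) $\lambda$-terms $X$ and $Y$, if $X$ $\beta\mathbf{\Omega}$-converts to $Y$, then the $\lambda$-closures of $X$ and $Y$ (formed by abstracting the same list $z_1,\dots,z_t$ of all variables free in $X$ or $Y$) satisfy $\lambda z_1\dots z_t.X =_{\omega} \lambda z_1\dots z_t.Y$.
   Context: $[N/x]U$ is capture-avoiding substitution; $\mathbf{\Omega}\equiv(\lambda x.xx)(\lambda x.xx)$; a term is unsolvable if its closure applied to no sequence of closed terms $\beta$-converts to $\lambda x.x$. $\beta\mathbf{\Omega}$-conversion is the convertibility relation generated by $\beta$-reduction together with the rule $U\to\mathbf{\Omega}$ for $U$ unsolvable with $U\not\equiv\mathbf{\Omega}$, closed under contexts. The relation $=_{\omega}$ on closed terms is the least relation such that: $M=_\omega M$; $(\lambda x.U)N =_{\omega} [N/x]U$ and $[N/x]U =_\omega (\lambda x.U)N$ for closed $(\lambda x.U)N$; $M=_\omega\mathbf{\Omega}$ and $\mathbf{\Omega}=_\omega M$ for closed unsolvable $M$; if $X,Y$ have no free variable other than possibly $z$, $[M/z]X=_\omega[M/z]Y$ and $M=_\omega N$, then $[N/z]X=_\omega[N/z]Y$ (Leibniz rule); and if $PM=_\omega QM$ for all closed $M$ then $P=_\omega Q$ ($\omega$-rule). -}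

module Defs where

open import Data.Nat using (ℕ; zero; suc)
open import Data.Fin using (Fin; zero; suc)
open import Data.List using (List; []; _∷_)
open import Data.Product using (∃)
open import Relation.Nullary using (¬_)
open import Relation.Binary.PropositionalEquality using (_≡_)
open import Relation.Binary.Construct.Closure.Equivalence using (EqClosure)

-- Well-scoped de Bruijn λ-terms; Term n = terms whose free variables are among n.
-- Syntactic identity ≡ on these terms is α-equivalence.
infixl 7 _·_
data Term (n : ℕ) : Set where
  var : Fin n → Term n
  ƛ   : Term (suc n) → Term n
  _·_ : Term n → Term n → Term n

Closed : Set
Closed = Term 0

ext : ∀ {m n} → (Fin m → Fin n) → Fin (suc m) → Fin (suc n)
ext ρ zero    = zero
ext ρ (suc i) = suc (ρ i)

rename : ∀ {m n} → (Fin m → Fin n) → Term m → Term n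
rename ρ (var i) = var (ρ i)
rename ρ (ƛ t)   = ƛ (rename (ext ρ) t)
rename ρ (s · t) = rename ρ s · rename ρ t

exts : ∀ {m n} → (Fin m → Term n) → Fin (suc m) → Term (suc n)
exts σ zero    = var zero
exts σ (suc i) = rename suc (σ i)

subst : ∀ {m n} → (Fin m → Term n) → Term m → Term n
subst σ (var i) = σ i
subst σ (ƛ t)   = ƛ (subst (exts σ) t)
subst σ (s · t) = subst σ s · subst σ t

sub0 : ∀ {n} → Term n → Fin (suc n) → Term n
sub0 N zero    = N
sub0 N (suc i) = var i

_[_] : ∀ {n} → Term (suc n) → Term n → Term n
U [ N ] = subst (sub0 N) U

data _∈FV_ {n : ℕ} : Fin n → Term n → Set where
  fv-var : ∀ {i} → i ∈FV var i
  fv-ƛ   : ∀ {i t} → suc i ∈FV t → i ∈FV ƛ t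
  fv-·ˡ  : ∀ {i s t} → i ∈FV s → i ∈FV (s · t)
  fv-·ʳ  : ∀ {i s t} → i ∈FV t → i ∈FV (s · t)

close : ∀ {n} → Term n → Closed
close {zero}  t = t
close {suc n} t = close (ƛ t)

I : ∀ {n} → Term n
I = ƛ (var zero)

ω : ∀ {n} → Term n
ω = ƛ (var zero · var zero)

Ω : ∀ {n} → Term n
Ω = ω · ω

data _→β_ {n : ℕ} : Term n → Term n → Set where
  β     : ∀ {U N} → (ƛ U · N) →β (U [ N ])
  ξ-ƛ   : ∀ {U U'} → U →β U' → ƛ U →β ƛ U'
  ξ-·ˡ  : ∀ {s s' t} → s →β s' → (s · t) →β (s' · t)
  ξ-·ʳ  : ∀ {s t t'} → t →β t' → (s · t) →β (s · t')

_=β_ : ∀ {n} → Term n → Term n → Set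
_=β_ = EqClosure _→β_

apps : ∀ {n} → Term n → List (Term n) → Term n
apps t []       = t
apps t (M ∷ Ms) = apps (t · M) Ms

Solvable : ∀ {n} → Term n → Set
Solvable U = ∃ λ (Ms : List Closed) → apps (close U) Ms =β I

Unsolvable : ∀ {n} → Term n → Set
Unsolvable U = ¬ Solvable U

data _→βΩ_ {n : ℕ} : Term n → Term n → Set where
  β     : ∀ {U N} → (ƛ U · N) →βΩ (U [ N ])
  Ω-rule : ∀ {U} → Unsolvable U → ¬ (U ≡ Ω) → U →βΩ Ω
  ξ-ƛ   : ∀ {U U'} → U →βΩ U' → ƛ U →βΩ ƛ U'
  ξ-·ˡ  : ∀ {s s' t} → s →βΩ s' → (s · t) →βΩ (s' · t)
  ξ-·ʳ  : ∀ {s t t'} → t →βΩ t' → (s · t) →βΩ (s · t')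

_=βΩ_ : ∀ {n} → Term n → Term n → Set
_=βΩ_ = EqClosure _→βΩ_

data _=ω_ : Closed → Closed → Set where
  ω-refl  : ∀ {M} → M =ω M
  ω-β     : ∀ {U : Term 1} {N : Closed} → (ƛ U · N) =ω (U [ N ])
  ω-β⁻¹   : ∀ {U : Term 1} {N : Closed} → (U [ N ]) =ω (ƛ U · N)
  ω-Ω     : ∀ {M : Closed} → Unsolvable M → M =ω Ω
  ω-Ω⁻¹   : ∀ {M : Closed} → Unsolvable M → Ω =ω M
  leibniz : ∀ {X Y : Term 1} {M N : Closed} →
            (X [ M ]) =ω (Y [ M ]) → M =ω N → (X [ N ]) =ω (Y [ N ])
  ω-rule  : ∀ {P Q : Closed} → ((M : Closed) → (P · M) =ω (Q · M)) → P =ω Q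

{-# OPTIONS --safe #-}
-- Call open terms X and Y ω-equivalent when every closed instance of X is =ω to the
-- corresponding instance of Y. Each βΩ-step is an ω-equivalence: β commutes with closed
-- substitution, a closed instance of an unsolvable term is unsolvable (the closure of the
-- term applied to the substituted terms β-reduces to the instance), and the compatible
-- closure is handled by the Leibniz rule for applications and by the ω-rule for
-- abstractions. The ω-rule also shows that λ-abstraction, hence closure, preserves
-- ω-equivalence, and a closed term is its own only closed instance.
module Submission where

open import Defs
open import Data.Nat using (ℕ; zero; suc)
open import Data.Fin using (Fin; zero; suc)
open import Data.List using (List; []; _∷_)
open import Data.Product using (_,_)
open import Data.Sum using (_⊎_)
open import Data.Vec.Functional using (head; tail) renaming (_∷_ to _∷ᶠ_)
open import Function using (_∘′_)
open import Relation.Binary.Structures using (IsEquivalence)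
open import Relation.Binary.PropositionalEquality
  using (_≡_; refl; sym; trans; cong; cong₂; subst₂)
open import Relation.Binary.Construct.Closure.ReflexiveTransitive using (ε; _◅_; _◅◅_)
open import Relation.Binary.Construct.Closure.Symmetric using (fwd)
open import Relation.Binary.Construct.Closure.Equivalence using (fold)

private
  variable
    l m n : ℕ

ext-cong : {ρ ρ′ : Fin m → Fin n} → (∀ i → ρ i ≡ ρ′ i) → ∀ i → ext ρ i ≡ ext ρ′ i
ext-cong h zero    = refl
ext-cong h (suc i) = cong suc (h i)

rename-cong : {ρ ρ′ : Fin m → Fin n} → (∀ i → ρ i ≡ ρ′ i) → ∀ t → rename ρ t ≡ rename ρ′ t
rename-cong h (var i) = cong var (h i)
rename-cong h (ƛ t)   = cong ƛ (rename-cong (ext-cong h) t)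
rename-cong h (s · t) = cong₂ _·_ (rename-cong h s) (rename-cong h t)

exts-cong : {σ σ′ : Fin m → Term n} → (∀ i → σ i ≡ σ′ i) → ∀ i → exts σ i ≡ exts σ′ i
exts-cong h zero    = refl
exts-cong h (suc i) = cong (rename suc) (h i)

subst-cong : {σ σ′ : Fin m → Term n} → (∀ i → σ i ≡ σ′ i) → ∀ t → subst σ t ≡ subst σ′ t
subst-cong h (var i) = h i
subst-cong h (ƛ t)   = cong ƛ (subst-cong (exts-cong h) t)
subst-cong h (s · t) = cong₂ _·_ (subst-cong h s) (subst-cong h t)

rename-rename : (ρ : Fin m → Fin n) (τ : Fin l → Fin m) (t : Term l) →
                rename ρ (rename τ t) ≡ rename (λ i → ρ (τ i)) t
rename-rename ρ τ (var i) = refl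
rename-rename ρ τ (ƛ t)   = cong ƛ (trans (rename-rename (ext ρ) (ext τ) t)
                                          (rename-cong (λ { zero → refl ; (suc i) → refl }) t))
rename-rename ρ τ (s · t) = cong₂ _·_ (rename-rename ρ τ s) (rename-rename ρ τ t)

subst-rename : (σ : Fin m → Term n) (τ : Fin l → Fin m) (t : Term l) →
               subst σ (rename τ t) ≡ subst (λ i → σ (τ i)) t
subst-rename σ τ (var i) = refl
subst-rename σ τ (ƛ t)   = cong ƛ (trans (subst-rename (exts σ) (ext τ) t)
                                         (subst-cong (λ { zero → refl ; (suc i) → refl }) t))
subst-rename σ τ (s · t) = cong₂ _·_ (subst-rename σ τ s) (subst-rename σ τ t)

rename-subst : (ρ : Fin m → Fin n) (σ : Fin l → Term m) (t : Term l) →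
               rename ρ (subst σ t) ≡ subst (λ i → rename ρ (σ i)) t
rename-subst ρ σ (var i) = refl
rename-subst ρ σ (ƛ t)   = cong ƛ (trans (rename-subst (ext ρ) (exts σ) t) (subst-cong commute t))
  where
  commute : ∀ i → rename (ext ρ) (exts σ i) ≡ exts (λ j → rename ρ (σ j)) i
  commute zero    = refl
  commute (suc i) = trans (rename-rename (ext ρ) suc (σ i)) (sym (rename-rename suc ρ (σ i)))
rename-subst ρ σ (s · t) = cong₂ _·_ (rename-subst ρ σ s) (rename-subst ρ σ t)

subst-subst : (τ : Fin m → Term n) (σ : Fin l → Term m) (t : Term l) →
              subst τ (subst σ t) ≡ subst (λ i → subst τ (σ i)) t
subst-subst τ σ (var i) = refl
subst-subst τ σ (ƛ t)   = cong ƛ (trans (subst-subst (exts τ) (exts σ) t) (subst-cong commute t))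
  where
  commute : ∀ i → subst (exts τ) (exts σ i) ≡ exts (λ j → subst τ (σ j)) i
  commute zero    = refl
  commute (suc i) = trans (subst-rename (exts τ) suc (σ i)) (sym (rename-subst suc τ (σ i)))
subst-subst τ σ (s · t) = cong₂ _·_ (subst-subst τ σ s) (subst-subst τ σ t)

subst-id : {σ : Fin n → Term n} → (∀ i → σ i ≡ var i) → ∀ t → subst σ t ≡ t
subst-id h (var i) = h i
subst-id h (ƛ t)   = cong ƛ (subst-id (λ { zero → refl ; (suc i) → cong (rename suc) (h i) }) t)
subst-id h (s · t) = cong₂ _·_ (subst-id h s) (subst-id h t)

subst-closed : (σ : Fin 0 → Closed) (t : Closed) → subst σ t ≡ t
subst-closed σ = subst-id (λ ())

subst-rename-id : {σ : Fin n → Term m} {ρ : Fin m → Fin n} →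
                  (∀ i → σ (ρ i) ≡ var i) → ∀ t → subst σ (rename ρ t) ≡ t
subst-rename-id {σ = σ} {ρ} h t = trans (subst-rename σ ρ t) (subst-id h t)

subst-exts-[] : (σ : Fin (suc m) → Term n) (U : Term (suc m)) →
                subst (exts (tail σ)) U [ head σ ] ≡ subst σ U
subst-exts-[] σ U = trans (subst-subst (sub0 (head σ)) (exts (tail σ)) U) (subst-cong step U)
  where
  step : ∀ i → subst (sub0 (head σ)) (exts (tail σ) i) ≡ σ i
  step zero    = refl
  step (suc i) = subst-rename-id (λ _ → refl) (σ (suc i))

subst-[] : (σ : Fin m → Term n) (U : Term (suc m)) (N : Term m) →
           subst σ (U [ N ]) ≡ subst (exts σ) U [ subst σ N ]
subst-[] σ U N = trans (subst-subst σ (sub0 N) U)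
  (trans (subst-cong (λ { zero → refl ; (suc i) → refl }) U)
         (sym (subst-exts-[] (subst σ N ∷ᶠ σ) U)))

weaken : Closed → Term 1
weaken = rename (λ ())

weaken-[] : (M N : Closed) → weaken M [ N ] ≡ M
weaken-[] M N = subst-rename-id (λ ()) M

leibnizˡ : (K : Closed) (C : Term 1) {M N : Closed} →
           K =ω (C [ M ]) → M =ω N → K =ω (C [ N ])
leibnizˡ K C {M} {N} K=CM = subst₂ _=ω_ (weaken-[] K N) refl
  ∘′ leibniz {weaken K} {C} (subst₂ _=ω_ (sym (weaken-[] K M)) refl K=CM)

=ω-sym : {M N : Closed} → M =ω N → N =ω M
=ω-sym {M} {N} M=N = subst₂ _=ω_ refl (weaken-[] M N)
  (leibniz {var zero} {weaken M} (subst₂ _=ω_ refl (sym (weaken-[] M M)) ω-refl) M=N)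

=ω-trans : {M N P : Closed} → M =ω N → N =ω P → M =ω P
=ω-trans {M} = leibnizˡ M (var zero)

=ω-cong : (C : Term 1) {M N : Closed} → M =ω N → (C [ M ]) =ω (C [ N ])
=ω-cong C {M} = leibnizˡ (C [ M ]) C ω-refl

·-congˡ : {M N P : Closed} → M =ω N → (M · P) =ω (N · P)
·-congˡ {M} {N} {P} = subst₂ _=ω_ (cong (M ·_) (weaken-[] P M)) (cong (N ·_) (weaken-[] P N))
                    ∘′ =ω-cong (var zero · weaken P)

·-congʳ : {M N P : Closed} → M =ω N → (P · M) =ω (P · N)
·-congʳ {M} {N} {P} = subst₂ _=ω_ (cong (_· M) (weaken-[] P M)) (cong (_· N) (weaken-[] P N))
                    ∘′ =ω-cong (weaken P · var zero)

ƛ-cong : {A B : Term 1} → (∀ M → (A [ M ]) =ω (B [ M ])) → ƛ A =ω ƛ B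
ƛ-cong A=B = ω-rule (λ M → =ω-trans ω-β (=ω-trans (A=B M) ω-β⁻¹))

apps-→β : {s s′ : Term n} (Ms : List (Term n)) → s →β s′ → apps s Ms →β apps s′ Ms
apps-→β []       r = r
apps-→β (M ∷ Ms) r = apps-→β Ms (ξ-·ˡ r)

-- closingArgs σ Ms = σ (n-1) ∷ … ∷ σ 0 ∷ Ms: close binds index n-1 outermost.
closingArgs : (Fin n → Closed) → List Closed → List Closed
closingArgs {zero}  σ Ms = Ms
closingArgs {suc n} σ Ms = closingArgs (tail σ) (head σ ∷ Ms)

close-apps : (σ : Fin n → Closed) (U : Term n) (Ms : List Closed) →
             apps (close U) (closingArgs σ Ms) =β apps (subst σ U) Ms
close-apps {zero} σ U Ms rewrite subst-closed σ U = ε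
close-apps {suc n} σ U Ms =
  close-apps (tail σ) (ƛ U) (head σ ∷ Ms) ◅◅ fwd (apps-→β Ms β) ◅ instantiate
  where
  instantiate : apps (subst (exts (tail σ)) U [ head σ ]) Ms =β apps (subst σ U) Ms
  instantiate rewrite subst-exts-[] σ U = ε

Unsolvable-subst : (σ : Fin n → Closed) {U : Term n} → Unsolvable U → Unsolvable (subst σ U)
Unsolvable-subst σ {U} unsolvable (Ms , σU-solved) =
  unsolvable (closingArgs σ Ms , close-apps σ U Ms ◅◅ σU-solved)

_≈ω_ : Term n → Term n → Set
_≈ω_ {n} X Y = (σ : Fin n → Closed) → subst σ X =ω subst σ Y

≈ω-isEquivalence : IsEquivalence (_≈ω_ {n})
≈ω-isEquivalence = record
  { refl  = λ σ → ω-refl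
  ; sym   = λ X≈Y σ → =ω-sym (X≈Y σ)
  ; trans = λ X≈Y Y≈Z σ → =ω-trans (X≈Y σ) (Y≈Z σ)
  }

ƛ-cong-≈ω : {X Y : Term (suc n)} → X ≈ω Y → ƛ X ≈ω ƛ Y
ƛ-cong-≈ω {X = X} {Y} X≈Y σ = ƛ-cong λ M →
  subst₂ _=ω_ (sym (subst-exts-[] (M ∷ᶠ σ) X)) (sym (subst-exts-[] (M ∷ᶠ σ) Y)) (X≈Y (M ∷ᶠ σ))

→βΩ⇒≈ω : {X Y : Term n} → X →βΩ Y → X ≈ω Y
→βΩ⇒≈ω (β {U} {N})              σ = subst₂ _=ω_ refl (sym (subst-[] σ U N)) ω-β
→βΩ⇒≈ω (Ω-rule unsolvable _)   σ = ω-Ω (Unsolvable-subst σ unsolvable)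
→βΩ⇒≈ω (ξ-ƛ {U} {U′} r)         = ƛ-cong-≈ω {X = U} {U′} (→βΩ⇒≈ω r)
→βΩ⇒≈ω (ξ-·ˡ r)                σ = ·-congˡ (→βΩ⇒≈ω r σ)
→βΩ⇒≈ω (ξ-·ʳ r)                σ = ·-congʳ (→βΩ⇒≈ω r σ)

=βΩ⇒≈ω : {X Y : Term n} → X =βΩ Y → X ≈ω Y
=βΩ⇒≈ω = fold ≈ω-isEquivalence →βΩ⇒≈ω

close-cong : {X Y : Term n} → X ≈ω Y → close X =ω close Y
close-cong {zero}  {X} {Y} X≈Y = subst₂ _=ω_ (subst-closed _ X) (subst-closed _ Y) (X≈Y (λ ()))
close-cong {suc n} {X} {Y} X≈Y = close-cong (ƛ-cong-≈ω {X = X} {Y} X≈Y)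

-- The free-variable hypothesis only pins down which closure the paper takes; closing over
-- any scope containing the free variables works.
proposition3p4 : ∀ {n : ℕ} (X Y : Term n) →
    (∀ (i : Fin n) → (i ∈FV X) ⊎ (i ∈FV Y)) →
    X =βΩ Y → close X =ω close Y
proposition3p4 X Y _ X=Y = close-cong (=βΩ⇒≈ω X=Y)
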